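{- Let $p$ be a prime and let $e=(\mathbf e_1,\dots,\mathbf e_{q_1})$ and $f=(\mathbf f_1,\dots,\mathbf f_{q_2})$ be two sequences of vectors in $\mathbb N^d$ with $|e|=|f|$. Then for all $s\in\mathbb N$, $\mathbf c\in\{0,\dots,p^s-1\}^d$ and $\mathbf m\in\mathbb N^d$, $$\frac{\mathcal Q_{e,f}(\mathbf c)}{\mathcal Q_{e,f}(\mathbf cp)}\cdot\frac{\mathcal Q_{e,f}(\mathbf cp+\mathbf mp^{s+1})}{\mathcal Q_{e,f}(\mathbf c+\mathbf mp^s)}\in1+p^{s+1}\mathbb Z_p.$$
   Context: $|e|=\sum_i\mathbf e_i$, $|f|=\sum_j\mathbf f_j$, and $\mathcal Q_{e,f}(\mathbf n)=\frac{(\mathbf e_1\cdot\mathbf n)!\cdots(\mathbf e_{q_1}\cdot\mathbf n)!}{(\mathbf f_1\cdot\mathbf n)!\cdots(\mathbf f_{q_2}\cdot\mathbf n)!}$ for $\mathbf n\in\mathbb N^d$. -}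

module Defs where

open import Data.Nat as ℕ using (ℕ; zero; suc; _!; _^_; NonZero)
open import Data.Nat.Divisibility using (_∣_)
open import Data.Nat.Properties using (_!≢0; m*n≢0)
open import Data.Integer using (+_)
open import Data.List using (List; []; _∷_; foldr)
open import Data.Vec using (Vec; zipWith; replicate; map)
open import Data.Vec using () renaming (foldr′ to vfoldr)
open import Data.Rational as ℚ using (ℚ; _/_; _*_; _+_; 1ℚ; _÷_)
open import Data.Rational.Properties using (normalize-pos; pos⇒nonZero)
open import Data.Product using (∃; _×_)
open import Relation.Nullary using (¬_)
open import Relation.Binary.PropositionalEquality using (_≡_)

Vecℕ : ℕ → Set
Vecℕ d = Vec ℕ d

_·_ : ∀ {d} → Vecℕ d → Vecℕ d → ℕ
a · n = vfoldr (λ x y → x ℕ.+ y) 0 (zipWith ℕ._*_ a n)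

_⊕_ : ∀ {d} → Vecℕ d → Vecℕ d → Vecℕ d
_⊕_ = zipWith ℕ._+_

_⊛_ : ∀ {d} → Vecℕ d → ℕ → Vecℕ d
v ⊛ k = map (λ x → x ℕ.* k) v

∣_∣ᵥ : ∀ {d} → List (Vecℕ d) → Vecℕ d
∣_∣ᵥ {d} = foldr _⊕_ (replicate d 0)

prodFact : ∀ {d} → List (Vecℕ d) → Vecℕ d → ℕ
prodFact [] n = 1
prodFact (a ∷ as) n = (a · n) ! ℕ.* prodFact as n

prodFact-nonZero : ∀ {d} (as : List (Vecℕ d)) (n : Vecℕ d) → NonZero (prodFact as n)
prodFact-nonZero [] n = _
prodFact-nonZero (a ∷ as) n =
  m*n≢0 ((a · n) !) (prodFact as n) {{(a · n) !≢0}} {{prodFact-nonZero as n}}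

Q : ∀ {d} → List (Vecℕ d) → List (Vecℕ d) → Vecℕ d → ℚ
Q e f n = ((+ prodFact e n) / prodFact f n) {{prodFact-nonZero f n}}

Q-nonZero : ∀ {d} (e f : List (Vecℕ d)) (n : Vecℕ d) → ℚ.NonZero (Q e f n)
Q-nonZero e f n =
  pos⇒nonZero (Q e f n) {{normalize-pos (prodFact e n) (prodFact f n) {{prodFact-nonZero f n}} {{prodFact-nonZero e n}}}}

Qratio : ∀ {d} → List (Vecℕ d) → List (Vecℕ d) → Vecℕ d → Vecℕ d → ℚ
Qratio e f a b = (Q e f a ÷ Q e f b) {{Q-nonZero e f b}}

-- x ∈ ℤ_p (for rational x): p does not divide the (reduced) denominator of x
InZp : ℕ → ℚ → Set
InZp p x = ¬ (p ∣ ℚ.denominatorℕ x)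

In1+p^tZp : ℕ → ℕ → ℚ → Set
In1+p^tZp p t x = ∃ λ y → InZp p y × (x ≡ 1ℚ + ((+ (p ^ t)) / 1) * y)

module Submission where

open import Data.Nat using (ℕ; NonZero)
open import Defs using (Vecℕ)

-- For a vector v, with a = v·c and L = (v·m) pˢ,
--     a! (ap + Lp)! = (ap)! (a + L)! · p^L · unitProd (ap) (Lp),
--   where unitProd x n is the product of x+1, …, x+n with every multiple of p deleted:
--   the deleted multiples of p contribute exactly p^L (a+1)⋯(a+L).
-- • Periodicity (unitProd-periods).  Modulo M = pˢ⁺¹ the factors of unitProd only
--   depend on their residue, so a product over k·M consecutive integers is W^k mod M,
--   with W = unitProd 0 M independent of the starting point.
-- • Taking the product over the vectors of e (resp. f), the double ratio of the theorem
--   equals X/Y, where X, Y are products of unitProd's; the powers of p cancel because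
--   |e| = |f|, and X ≡ W^{|e|·m} = W^{|f|·m} ≡ Y (mod M) with p ∤ Y.
-- • Finally (congruent-units-ratio), if X ≡ Y (mod pᵏ) and p ∤ Y then X/Y ∈ 1 + pᵏ ℤ_p.

-- Arithmetic in ℕ: the p-free parts of factorials.
module Factorials where

  open import Data.Nat
  open import Data.Nat.Properties
  open import Data.Nat.Divisibility
  open import Data.Nat.DivMod
  open import Data.Nat.Primality using (Prime; euclidsLemma; ¬prime[1])
  open import Data.Nat.Tactic.RingSolver using (solve-∀)
  open import Data.Sum using (inj₁; inj₂)
  open import Data.Empty using (⊥-elim)
  open import Relation.Nullary using (¬_; yes; no)
  open import Relation.Binary.PropositionalEquality

  *-cong-mod : ∀ {M a a′ b b′} .{{_ : NonZero M}} →
               a % M ≡ a′ % M → b % M ≡ b′ % M → (a * b) % M ≡ (a′ * b′) % M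
  *-cong-mod {M} {a} {a′} {b} {b′} a≡a′ b≡b′ = begin
    (a * b) % M                ≡⟨ %-distribˡ-* a b M ⟩
    ((a % M) * (b % M)) % M    ≡⟨ cong₂ (λ u v → (u * v) % M) a≡a′ b≡b′ ⟩
    ((a′ % M) * (b′ % M)) % M  ≡⟨ %-distribˡ-* a′ b′ M ⟨
    (a′ * b′) % M              ∎
    where open ≡-Reasoning

  ∤-* : ∀ {p a b} → Prime p → ¬ p ∣ a → ¬ p ∣ b → ¬ p ∣ a * b
  ∤-* {a = a} {b} p-prime p∤a p∤b p∣ab with euclidsLemma a b p-prime p∣ab
  ... | inj₁ p∣a = p∤a p∣a
  ... | inj₂ p∣b = p∤b p∣b

  ∤1 : ∀ {p} → Prime p → ¬ p ∣ 1
  ∤1 p-prime p∣1 = ¬prime[1] (subst Prime (∣1⇒≡1 p∣1) p-prime)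

  ∤⇒nonZero : ∀ {p n} → ¬ p ∣ n → NonZero n
  ∤⇒nonZero {p} p∤n = ≢-nonZero (λ n≡0 → p∤n (subst (p ∣_) (sym n≡0) (p ∣0)))

  module UnitParts (p : ℕ) .{{_ : NonZero p}} where
    open ≡-Reasoning

    unitPart : ℕ → ℕ
    unitPart y with p ∣? y
    ... | yes _ = 1
    ... | no _  = y

    unitPart-unit : ∀ {y} → ¬ p ∣ y → unitPart y ≡ y
    unitPart-unit {y} p∤y with p ∣? y
    ... | yes p∣y = ⊥-elim (p∤y p∣y)
    ... | no _    = refl

    unitPart-mult : ∀ {y} → p ∣ y → unitPart y ≡ 1
    unitPart-mult {y} p∣y with p ∣? y
    ... | yes _   = refl
    ... | no p∤y  = ⊥-elim (p∤y p∣y)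

    unitProd : ℕ → ℕ → ℕ
    unitProd x zero    = 1
    unitProd x (suc n) = unitProd x n * unitPart (x + suc n)

    unitProd-+ : ∀ x n k → unitProd x (n + k) ≡ unitProd x n * unitProd (x + n) k
    unitProd-+ x n zero    = trans (cong (unitProd x) (+-identityʳ n)) (sym (*-identityʳ _))
    unitProd-+ x n (suc k) = begin
      unitProd x (n + suc k)                            ≡⟨ cong (unitProd x) (+-suc n k) ⟩
      unitProd x (n + k) * unitPart (x + suc (n + k))   ≡⟨ cong₂ _*_ (unitProd-+ x n k) (cong unitPart shift) ⟩
      unitProd x n * unitProd (x + n) k * unitPart (x + n + suc k) ≡⟨ *-assoc (unitProd x n) _ _ ⟩
      unitProd x n * unitProd (x + n) (suc k)           ∎
      where
      shift : x + suc (n + k) ≡ x + n + suc k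
      shift = trans (cong (x +_) (sym (+-suc n k))) (sym (+-assoc x n (suc k)))

    -- Between a multiple x of p and the next multiple no factor is deleted.
    partial-block : ∀ x n → p ∣ x → n < p → (x + n) ! ≡ x ! * unitProd x n
    partial-block x zero    _   _     = trans (cong _! (+-identityʳ x)) (sym (*-identityʳ _))
    partial-block x (suc n) p∣x n+1<p = begin
      (x + suc n) !                              ≡⟨ cong _! (+-suc x n) ⟩
      suc (x + n) * (x + n) !                    ≡⟨ cong₂ _*_ (sym (+-suc x n)) (partial-block x n p∣x (<-trans (n<1+n n) n+1<p)) ⟩
      (x + suc n) * (x ! * unitProd x n)         ≡⟨ cong (_* (x ! * unitProd x n)) (sym (unitPart-unit p∤x+n+1)) ⟩
      unitPart (x + suc n) * (x ! * unitProd x n) ≡⟨ rearrange (unitPart (x + suc n)) (x !) (unitProd x n) ⟩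
      x ! * unitProd x (suc n)                   ∎
      where
      p∤x+n+1 : ¬ p ∣ x + suc n
      p∤x+n+1 p∣ = <⇒≱ n+1<p (∣⇒≤ (∣m+n∣m⇒∣n p∣ p∣x))
      rearrange : ∀ u a b → u * (a * b) ≡ a * (b * u)
      rearrange = solve-∀

    -- A full block x+1, …, x+p (p ∣ x): only the last factor x+p is deleted.
    block : ∀ x → p ∣ x → (x + p) ! ≡ x ! * unitProd x p * (x + p)
    block x p∣x = subst (λ k → (x + k) ! ≡ x ! * unitProd x k * (x + k)) p-1+1≡p (last-step (pred p) p-1+1≡p)
      where
      p-1+1≡p : suc (pred p) ≡ p
      p-1+1≡p = suc-pred p
      last-step : ∀ n → suc n ≡ p → (x + suc n) ! ≡ x ! * unitProd x (suc n) * (x + suc n)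
      last-step n n+1≡p = begin
        (x + suc n) !                                  ≡⟨ cong _! (+-suc x n) ⟩
        suc (x + n) * (x + n) !                        ≡⟨ cong₂ _*_ (sym (+-suc x n)) (partial-block x n p∣x (≤-reflexive n+1≡p)) ⟩
        (x + suc n) * (x ! * unitProd x n)             ≡⟨ rearrange (x + suc n) (x !) (unitProd x n) ⟩
        x ! * (unitProd x n * 1) * (x + suc n)         ≡⟨ cong (λ u → x ! * (unitProd x n * u) * (x + suc n)) (sym (unitPart-mult p∣x+n+1)) ⟩
        x ! * unitProd x (suc n) * (x + suc n)         ∎
        where
        p∣x+n+1 : p ∣ x + suc n
        p∣x+n+1 = ∣m∣n⇒∣m+n p∣x (subst (p ∣_) (sym n+1≡p) ∣-refl)
        rearrange : ∀ u a b → u * (a * b) ≡ a * (b * 1) * u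
        rearrange = solve-∀

    -- Legendre-type splitting: the factors of (Ap + Lp)!/(Ap)! that are multiples of p
    -- contribute p^L (A+1)⋯(A+L), the others form unitProd (A p) (L p).
    factorial-split : ∀ A L → A ! * (A * p + L * p) ! ≡ (A * p) ! * (A + L) ! * p ^ L * unitProd (A * p) (L * p)
    factorial-split A zero = begin
      A ! * (A * p + 0) !               ≡⟨ cong (λ n → A ! * n !) (+-identityʳ (A * p)) ⟩
      A ! * (A * p) !                   ≡⟨ rearrange (A !) ((A * p) !) ⟩
      (A * p) ! * A ! * 1 * 1           ≡⟨ cong (λ n → (A * p) ! * n ! * 1 * 1) (sym (+-identityʳ A)) ⟩
      (A * p) ! * (A + 0) ! * 1 * 1     ∎
      where
      rearrange : ∀ a b → a * b ≡ b * a * 1 * 1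
      rearrange = solve-∀
    factorial-split A (suc L) = begin
      A ! * (A * p + (p + L * p)) !                      ≡⟨ cong (λ n → A ! * n !) (+-reassoc (A * p) p (L * p)) ⟩
      A ! * (x + p) !                                    ≡⟨ cong (A ! *_) (block x (∣m∣n⇒∣m+n (n∣m*n A) (n∣m*n L))) ⟩
      A ! * (x ! * unitProd x p * (x + p))               ≡⟨ regroup (A !) (x !) (unitProd x p) (x + p) ⟩
      A ! * x ! * (unitProd x p * (x + p))               ≡⟨ cong₂ (λ u v → u * (unitProd x p * v)) (factorial-split A L) (top-factor A L p) ⟩
      (A * p) ! * (A + L) ! * p ^ L * unitProd (A * p) (L * p) * (unitProd x p * (suc (A + L) * p))
        ≡⟨ collect ((A * p) !) ((A + L) !) (p ^ L) (unitProd (A * p) (L * p)) (unitProd x p) (suc (A + L)) p ⟩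
      (A * p) ! * (suc (A + L) * (A + L) !) * (p * p ^ L) * (unitProd (A * p) (L * p) * unitProd x p)
        ≡⟨ cong₂ (λ n u → (A * p) ! * n ! * (p * p ^ L) * u) (sym (+-suc A L)) (sym (unitProd-+ (A * p) (L * p) p)) ⟩
      (A * p) ! * (A + suc L) ! * p ^ suc L * unitProd (A * p) (L * p + p)
        ≡⟨ cong (λ n → (A * p) ! * (A + suc L) ! * p ^ suc L * unitProd (A * p) n) (+-comm (L * p) p) ⟩
      (A * p) ! * (A + suc L) ! * p ^ suc L * unitProd (A * p) (suc L * p) ∎
      where
      x = A * p + L * p
      +-reassoc : ∀ a b c → a + (b + c) ≡ a + c + b
      +-reassoc = solve-∀
      top-factor : ∀ a l q → a * q + l * q + q ≡ suc (a + l) * q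
      top-factor = solve-∀
      regroup : ∀ a b c d → a * (b * c * d) ≡ a * b * (c * d)
      regroup = solve-∀
      collect : ∀ a b c d e s q → a * b * c * d * (e * (s * q)) ≡ a * (s * b) * (q * c) * (d * e)
      collect = solve-∀

    unitProd-coprime : Prime p → ∀ x n → ¬ p ∣ unitProd x n
    unitProd-coprime p-prime x zero    = ∤1 p-prime
    unitProd-coprime p-prime x (suc n) = ∤-* p-prime (unitProd-coprime p-prime x n) unitPart-coprime
      where
      unitPart-coprime : ¬ p ∣ unitPart (x + suc n)
      unitPart-coprime with p ∣? (x + suc n)
      ... | yes _  = ∤1 p-prime
      ... | no p∤y = p∤y

    module Periodicity (M : ℕ) .{{_ : NonZero M}} (p∣M : p ∣ M) where

      -- Units stay units, and keep their residue, under a shift by a multiple of M.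
      unitPart-periodic : ∀ y k → unitPart (y + k * M) % M ≡ unitPart y % M
      unitPart-periodic y k with p ∣? y
      ... | yes p∣y = cong (_% M) (unitPart-mult (∣m∣n⇒∣m+n p∣y (∣n⇒∣m*n k p∣M)))
      ... | no p∤y  = trans (cong (_% M) (unitPart-unit p∤shifted)) ([m+kn]%n≡m%n y k M)
        where
        p∤shifted : ¬ p ∣ y + k * M
        p∤shifted p∣ = p∤y (∣m+n∣m⇒∣n (subst (p ∣_) (+-comm y (k * M)) p∣) (∣n⇒∣m*n k p∣M))

      unitProd-shift : ∀ x k n → unitProd (x + k * M) n % M ≡ unitProd x n % M
      unitProd-shift x k zero    = refl
      unitProd-shift x k (suc n) = *-cong-mod (unitProd-shift x k n) (begin
        unitPart (x + k * M + suc n) % M  ≡⟨ cong (λ y → unitPart y % M) (swap x (k * M) (suc n)) ⟩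
        unitPart (x + suc n + k * M) % M  ≡⟨ unitPart-periodic (x + suc n) k ⟩
        unitPart (x + suc n) % M          ∎)
        where
        swap : ∀ a b c → a + b + c ≡ a + c + b
        swap = solve-∀

      -- Split M = (M ∸ r) + r with r = x mod M: the two pieces are, up to a shift by a
      -- multiple of M, the pieces r+1, …, M and 1, …, r of unitProd 0 M in the other order.
      unitProd-period : ∀ x → unitProd x M % M ≡ unitProd 0 M % M
      unitProd-period x = begin
        unitProd x M % M                                 ≡⟨ cong (λ y → unitProd y M % M) (m≡m%n+[m/n]*n x M) ⟩
        unitProd (r + (x / M) * M) M % M                 ≡⟨ unitProd-shift r (x / M) M ⟩
        unitProd r M % M                                 ≡⟨ cong (λ n → unitProd r n % M) (m∸n+n≡m r≤M) ⟨
        unitProd r ((M ∸ r) + r) % M                     ≡⟨ cong (_% M) (unitProd-+ r (M ∸ r) r) ⟩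
        (unitProd r (M ∸ r) * unitProd (r + (M ∸ r)) r) % M  ≡⟨ *-cong-mod {a = unitProd r (M ∸ r)} refl wrap-around ⟩
        (unitProd r (M ∸ r) * unitProd 0 r) % M          ≡⟨ cong (_% M) (*-comm (unitProd r (M ∸ r)) (unitProd 0 r)) ⟩
        (unitProd 0 r * unitProd r (M ∸ r)) % M          ≡⟨ cong (_% M) (unitProd-+ 0 r (M ∸ r)) ⟨
        unitProd 0 (r + (M ∸ r)) % M                     ≡⟨ cong (λ n → unitProd 0 n % M) (m+[n∸m]≡n r≤M) ⟩
        unitProd 0 M % M                                 ∎
        where
        r = x % M
        r≤M : r ≤ M
        r≤M = m%n≤n x M
        wrap-around : unitProd (r + (M ∸ r)) r % M ≡ unitProd 0 r % M
        wrap-around = trans (cong (λ y → unitProd y r % M) (trans (m+[n∸m]≡n r≤M) (sym (+-identityʳ M))))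
                            (unitProd-shift 0 1 r)

      unitProd-periods : ∀ x k → unitProd x (k * M) % M ≡ (unitProd 0 M ^ k) % M
      unitProd-periods x zero    = refl
      unitProd-periods x (suc k) = begin
        unitProd x (M + k * M) % M                     ≡⟨ cong (_% M) (unitProd-+ x M (k * M)) ⟩
        (unitProd x M * unitProd (x + M) (k * M)) % M  ≡⟨ *-cong-mod (unitProd-period x) (unitProd-periods (x + M) k) ⟩
        (unitProd 0 M * unitProd 0 M ^ k) % M          ∎

module DotProduct where

  open import Defs using (_·_; _⊕_; _⊛_)
  open import Data.Nat
  open import Data.Nat.Tactic.RingSolver using (solve-∀)
  open import Data.Vec using ([]; _∷_; replicate)
  open import Relation.Binary.PropositionalEquality

  ·-⊛ : ∀ {d} (v x : Vecℕ d) k → v · (x ⊛ k) ≡ (v · x) * k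
  ·-⊛ []      []      k = refl
  ·-⊛ (a ∷ v) (b ∷ x) k = trans (cong (a * (b * k) +_) (·-⊛ v x k)) (distrib a b k (v · x))
    where
    distrib : ∀ a b k t → a * (b * k) + t * k ≡ (a * b + t) * k
    distrib = solve-∀

  ·-⊕ʳ : ∀ {d} (v x y : Vecℕ d) → v · (x ⊕ y) ≡ v · x + v · y
  ·-⊕ʳ []      []      []      = refl
  ·-⊕ʳ (a ∷ v) (b ∷ x) (c ∷ y) = trans (cong (a * (b + c) +_) (·-⊕ʳ v x y)) (distrib a b c (v · x) (v · y))
    where
    distrib : ∀ a b c t u → a * (b + c) + (t + u) ≡ a * b + t + (a * c + u)
    distrib = solve-∀

  ·-⊕ˡ : ∀ {d} (u w x : Vecℕ d) → (u ⊕ w) · x ≡ u · x + w · x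
  ·-⊕ˡ []      []      []      = refl
  ·-⊕ˡ (a ∷ u) (b ∷ w) (c ∷ x) = trans (cong ((a + b) * c +_) (·-⊕ˡ u w x)) (distrib a b c (u · x) (w · x))
    where
    distrib : ∀ a b c t u → (a + b) * c + (t + u) ≡ a * c + t + (b * c + u)
    distrib = solve-∀

  0·x≡0 : ∀ {d} (x : Vecℕ d) → replicate d 0 · x ≡ 0
  0·x≡0 []      = refl
  0·x≡0 (a ∷ x) = 0·x≡0 x

-- Rational numbers given as fractions.  The ℚ operations are transported from the
-- unnormalised rationals ℚᵘ, where they act on numerators and denominators directly.
module Fractions where

  open import Defs using (prodFact; prodFact-nonZero; Q; Q-nonZero; Qratio; InZp; In1+p^tZp)
  open import Data.Nat as ℕ using (ℕ; suc; NonZero; _^_)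
  import Data.Nat.Properties as ℕP
  open import Data.Nat.DivMod using (_%_; m≡m%n+[m/n]*n) renaming (_/_ to _div_)
  open import Data.Nat.Divisibility using (_∣_; divides; ∣-trans)
  import Data.Nat.Tactic.RingSolver as ℕSolver
  open import Data.Integer as ℤ using (ℤ; +_)
  import Data.Integer.Properties as ℤP
  open import Data.Integer.GCD using (gcd)
  open import Data.Integer.Tactic.RingSolver using (solve-∀)
  open import Data.Rational using (ℚ; _/_; _*_; _+_; _÷_; 1/_; 1ℚ; toℚᵘ)
  import Data.Rational as ℚ
  open import Data.Rational.Properties
    using (toℚᵘ-fromℚᵘ; toℚᵘ-injective; toℚᵘ-homo-*; toℚᵘ-homo-+; ↧-/; *-assoc; *-inverseʳ; *-identityʳ)
  import Data.Rational.Unnormalised as ℚᵘ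
  open import Data.Rational.Unnormalised using (_≃_; *≡*)
  import Data.Rational.Unnormalised.Properties as ℚᵘP
  open import Data.List using (List)
  open import Data.Product using (∃; _,_)
  open import Relation.Nullary using (¬_)
  open import Relation.Binary.PropositionalEquality

  /-toℚᵘ : ∀ i n .{{_ : NonZero n}} → toℚᵘ (i / n) ≃ (i ℚᵘ./ n)
  /-toℚᵘ i (suc n) = toℚᵘ-fromℚᵘ (ℚᵘ.mkℚᵘ i n)

  /-*-/ : ∀ i j a b .{{_ : NonZero a}} .{{_ : NonZero b}} →
          (i / a) * (j / b) ≡ ((i ℤ.* j) / (a ℕ.* b)) {{ℕP.m*n≢0 a b}}
  /-*-/ i j a@(suc _) b@(suc _) = toℚᵘ-injective (begin
    toℚᵘ ((i / a) * (j / b))        ≈⟨ toℚᵘ-homo-* (i / a) (j / b) ⟩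
    toℚᵘ (i / a) ℚᵘ.* toℚᵘ (j / b)  ≈⟨ ℚᵘP.*-cong (/-toℚᵘ i a) (/-toℚᵘ j b) ⟩
    (i ℤ.* j) ℚᵘ./ (a ℕ.* b)        ≈⟨ /-toℚᵘ (i ℤ.* j) (a ℕ.* b) ⟨
    toℚᵘ ((i ℤ.* j) / (a ℕ.* b))    ∎)
    where open ℚᵘP.≃-Reasoning

  /-+-/ : ∀ i j a b .{{_ : NonZero a}} .{{_ : NonZero b}} →
          (i / a) + (j / b) ≡ ((i ℤ.* + b ℤ.+ j ℤ.* + a) / (a ℕ.* b)) {{ℕP.m*n≢0 a b}}
  /-+-/ i j a@(suc _) b@(suc _) = toℚᵘ-injective (begin
    toℚᵘ ((i / a) + (j / b))                      ≈⟨ toℚᵘ-homo-+ (i / a) (j / b) ⟩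
    toℚᵘ (i / a) ℚᵘ.+ toℚᵘ (j / b)                ≈⟨ ℚᵘP.+-cong (/-toℚᵘ i a) (/-toℚᵘ j b) ⟩
    (i ℤ.* + b ℤ.+ j ℤ.* + a) ℚᵘ./ (a ℕ.* b)      ≈⟨ /-toℚᵘ (i ℤ.* + b ℤ.+ j ℤ.* + a) (a ℕ.* b) ⟨
    toℚᵘ ((i ℤ.* + b ℤ.+ j ℤ.* + a) / (a ℕ.* b))  ∎)
    where open ℚᵘP.≃-Reasoning

  /-cross : ∀ i j a b .{{_ : NonZero a}} .{{_ : NonZero b}} → i ℤ.* + b ≡ j ℤ.* + a → i / a ≡ j / b
  /-cross i j a@(suc _) b@(suc _) i*b≡j*a =
    toℚᵘ-injective (ℚᵘP.≃-trans (/-toℚᵘ i a) (ℚᵘP.≃-trans (*≡* i*b≡j*a) (ℚᵘP.≃-sym (/-toℚᵘ j b))))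

  /1-*-/ : ∀ i j n .{{_ : NonZero n}} → (i / 1) * (j / n) ≡ (i ℤ.* j) / n
  /1-*-/ i j n = trans (/-*-/ i j 1 n)
    (/-cross (i ℤ.* j) (i ℤ.* j) (1 ℕ.* n) n {{ℕP.m*n≢0 1 n}}
             (cong (λ k → i ℤ.* j ℤ.* + k) (sym (ℕP.*-identityˡ n))))

  1+-/ : ∀ j n .{{_ : NonZero n}} → 1ℚ + (j / n) ≡ (+ n ℤ.+ j) / n
  1+-/ j n = trans (/-+-/ (+ 1) j 1 n)
    (/-cross (+ 1 ℤ.* + n ℤ.+ j ℤ.* + 1) (+ n ℤ.+ j) (1 ℕ.* n) n {{ℕP.m*n≢0 1 n}}
             (cong₂ (λ u k → u ℤ.* + k) (cong₂ ℤ._+_ (ℤP.*-identityˡ (+ n)) (ℤP.*-identityʳ j))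
                                        (sym (ℕP.*-identityˡ n))))

  ℕ/-*-/ : ∀ a b c d .{{_ : NonZero b}} .{{_ : NonZero d}} →
           (+ a / b) * (+ c / d) ≡ (+ (a ℕ.* c) / (b ℕ.* d)) {{ℕP.m*n≢0 b d}}
  ℕ/-*-/ a b c d = trans (/-*-/ (+ a) (+ c) b d)
                         (cong (λ i → (i / (b ℕ.* d)) {{ℕP.m*n≢0 b d}}) (sym (ℤP.pos-* a c)))

  ℕ/-cross : ∀ a b c d .{{_ : NonZero b}} .{{_ : NonZero d}} → a ℕ.* d ≡ c ℕ.* b → + a / b ≡ + c / d
  ℕ/-cross a b c d a*d≡c*b = /-cross (+ a) (+ c) b d
    (trans (sym (ℤP.pos-* a d)) (trans (cong +_ a*d≡c*b) (ℤP.pos-* c b)))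

  ÷-unique : ∀ x y z .{{_ : ℚ.NonZero y}} → z * y ≡ x → x ÷ y ≡ z
  ÷-unique x y z refl = begin
    z * y * 1/ y    ≡⟨ *-assoc z y (1/ y) ⟩
    z * (y * 1/ y)  ≡⟨ cong (z *_) (*-inverseʳ y) ⟩
    z * 1ℚ          ≡⟨ *-identityʳ z ⟩
    z               ∎
    where open ≡-Reasoning

  denominator-∣ : ∀ i n .{{_ : NonZero n}} → ℚ.denominatorℕ (i / n) ∣ n
  denominator-∣ i n = divides g (ℤP.+-injective (begin
    + n                                  ≡⟨ ↧-/ i n ⟨
    + ℚ.denominatorℕ (i / n) ℤ.* + g     ≡⟨ ℤP.pos-* (ℚ.denominatorℕ (i / n)) g ⟨
    + (ℚ.denominatorℕ (i / n) ℕ.* g)     ≡⟨ cong +_ (ℕP.*-comm (ℚ.denominatorℕ (i / n)) g) ⟩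
    + (g ℕ.* ℚ.denominatorℕ (i / n))     ∎))
    where
    open ≡-Reasoning
    g = ℤ.∣ gcd i (+ n) ∣

  /-InZp : ∀ p i n .{{_ : NonZero n}} → ¬ p ∣ n → InZp p (i / n)
  /-InZp p i n p∤n p∣den = p∤n (∣-trans p∣den (denominator-∣ i n))

  %-lift : ∀ X Y M .{{_ : NonZero M}} → X % M ≡ Y % M → ∃ λ t → + X ≡ + Y ℤ.+ + M ℤ.* t
  %-lift X Y M X≡Y = qx ℤ.- qy , (begin
    + X                                               ≡⟨ decompose X ⟩
    + (X % M) ℤ.+ qx ℤ.* + M                          ≡⟨ cong (λ r → + r ℤ.+ qx ℤ.* + M) X≡Y ⟩
    + (Y % M) ℤ.+ qx ℤ.* + M                          ≡⟨ move (+ (Y % M)) qx qy (+ M) ⟩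
    + (Y % M) ℤ.+ qy ℤ.* + M ℤ.+ + M ℤ.* (qx ℤ.- qy)  ≡⟨ cong (ℤ._+ + M ℤ.* (qx ℤ.- qy)) (decompose Y) ⟨
    + Y ℤ.+ + M ℤ.* (qx ℤ.- qy)                       ∎)
    where
    open ≡-Reasoning
    qx qy : ℤ
    qx = + (X div M)
    qy = + (Y div M)
    decompose : ∀ n → + n ≡ + (n % M) ℤ.+ + (n div M) ℤ.* + M
    decompose n = trans (cong +_ (m≡m%n+[m/n]*n n M))
                        (trans (ℤP.pos-+ (n % M) (n div M ℕ.* M)) (cong (λ u → + (n % M) ℤ.+ u) (ℤP.pos-* (n div M) M)))
    move : ∀ r qx qy m → r ℤ.+ qx ℤ.* m ≡ r ℤ.+ qy ℤ.* m ℤ.+ m ℤ.* (qx ℤ.- qy)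
    move = solve-∀

  translate-unit : ∀ p k X Y t .{{_ : NonZero Y}} →
                   ¬ p ∣ Y → + X ≡ + Y ℤ.+ + (p ^ k) ℤ.* t → In1+p^tZp p k (+ X / Y)
  translate-unit p k X Y t p∤Y X≡Y+pᵏt = t / Y , /-InZp p t Y p∤Y , X/Y≡1+pᵏt/Y
    where
    open ≡-Reasoning
    X/Y≡1+pᵏt/Y : + X / Y ≡ 1ℚ + (+ (p ^ k) / 1) * (t / Y)
    X/Y≡1+pᵏt/Y = begin
      + X / Y                         ≡⟨ cong (λ i → i / Y) X≡Y+pᵏt ⟩
      (+ Y ℤ.+ + (p ^ k) ℤ.* t) / Y   ≡⟨ 1+-/ (+ (p ^ k) ℤ.* t) Y ⟨
      1ℚ + (+ (p ^ k) ℤ.* t) / Y      ≡⟨ cong (λ q → 1ℚ + q) (/1-*-/ (+ (p ^ k)) t Y) ⟨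
      1ℚ + (+ (p ^ k) / 1) * (t / Y)  ∎

  congruent-units-ratio : ∀ p k X Y .{{_ : NonZero (p ^ k)}} .{{_ : NonZero Y}} →
                          ¬ p ∣ Y → X % p ^ k ≡ Y % p ^ k → In1+p^tZp p k (+ X / Y)
  congruent-units-ratio p k X Y p∤Y X≡Y with %-lift X Y (p ^ k) X≡Y
  ... | t , X≡Y+pᵏt = translate-unit p k X Y t p∤Y X≡Y+pᵏt

  cross-multiply : ∀ {a b a′ b′ c d c′ d′ r x y} →
                   a ℕ.* b ≡ a′ ℕ.* b′ ℕ.* r ℕ.* x → c ℕ.* d ≡ c′ ℕ.* d′ ℕ.* r ℕ.* y →
                   a ℕ.* c′ ℕ.* (b ℕ.* d′) ℕ.* y ≡ x ℕ.* (c ℕ.* a′ ℕ.* (d ℕ.* b′))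
  cross-multiply {a} {b} {a′} {b′} {c} {d} {c′} {d′} {r} {x} {y} ab≡ cd≡ = begin
    a ℕ.* c′ ℕ.* (b ℕ.* d′) ℕ.* y                  ≡⟨ regroup₁ a b c′ d′ y ⟩
    a ℕ.* b ℕ.* (c′ ℕ.* d′ ℕ.* y)                  ≡⟨ cong (ℕ._* (c′ ℕ.* d′ ℕ.* y)) ab≡ ⟩
    a′ ℕ.* b′ ℕ.* r ℕ.* x ℕ.* (c′ ℕ.* d′ ℕ.* y)    ≡⟨ regroup₂ a′ b′ r x c′ d′ y ⟩
    x ℕ.* (a′ ℕ.* b′) ℕ.* (c′ ℕ.* d′ ℕ.* r ℕ.* y)  ≡⟨ cong (x ℕ.* (a′ ℕ.* b′) ℕ.*_) cd≡ ⟨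
    x ℕ.* (a′ ℕ.* b′) ℕ.* (c ℕ.* d)                ≡⟨ regroup₃ x a′ b′ c d ⟩
    x ℕ.* (c ℕ.* a′ ℕ.* (d ℕ.* b′))                ∎
    where
    open ≡-Reasoning
    regroup₁ : ∀ a b c′ d′ y → a ℕ.* c′ ℕ.* (b ℕ.* d′) ℕ.* y ≡ a ℕ.* b ℕ.* (c′ ℕ.* d′ ℕ.* y)
    regroup₁ = ℕSolver.solve-∀
    regroup₂ : ∀ a′ b′ r x c′ d′ y →
               a′ ℕ.* b′ ℕ.* r ℕ.* x ℕ.* (c′ ℕ.* d′ ℕ.* y) ≡ x ℕ.* (a′ ℕ.* b′) ℕ.* (c′ ℕ.* d′ ℕ.* r ℕ.* y)
    regroup₂ = ℕSolver.solve-∀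
    regroup₃ : ∀ x a′ b′ c d → x ℕ.* (a′ ℕ.* b′) ℕ.* (c ℕ.* d) ≡ x ℕ.* (c ℕ.* a′ ℕ.* (d ℕ.* b′))
    regroup₃ = ℕSolver.solve-∀

  module QuotientOfFactorials {d} (e f : List (Vecℕ d)) where

    E F : Vecℕ d → ℕ
    E = prodFact e
    F = prodFact f

    instance
      E≢0 : ∀ {z} → NonZero (E z)
      E≢0 {z} = prodFact-nonZero e z
      F≢0 : ∀ {z} → NonZero (F z)
      F≢0 {z} = prodFact-nonZero f z
      Q≢0 : ∀ {z} → ℚ.NonZero (Q e f z)
      Q≢0 {z} = Q-nonZero e f z

    FE≢0 : ∀ z w → NonZero (F z ℕ.* E w)
    FE≢0 z w = ℕP.m*n≢0 (F z) (E w)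

    Qratio-fraction : ∀ z w → Qratio e f z w ≡ (+ (E z ℕ.* F w) / (F z ℕ.* E w)) {{FE≢0 z w}}
    Qratio-fraction z w = ÷-unique (Q e f z) (Q e f w) _ (begin
      (+ (E z ℕ.* F w) / (F z ℕ.* E w)) {{FE≢0 z w}} * (+ E w / F w)
        ≡⟨ ℕ/-*-/ (E z ℕ.* F w) (F z ℕ.* E w) (E w) (F w) {{FE≢0 z w}} ⟩
      (+ (E z ℕ.* F w ℕ.* E w) / (F z ℕ.* E w ℕ.* F w)) {{FEF≢0}}
        ≡⟨ ℕ/-cross (E z ℕ.* F w ℕ.* E w) (F z ℕ.* E w ℕ.* F w) (E z) (F z) {{FEF≢0}} (cancel (E z) (F z) (E w) (F w)) ⟩
      + E z / F z
        ∎)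
      where
      open ≡-Reasoning
      FEF≢0 : NonZero (F z ℕ.* E w ℕ.* F w)
      FEF≢0 = ℕP.m*n≢0 (F z ℕ.* E w) (F w) {{FE≢0 z w}}
      cancel : ∀ a b c d → a ℕ.* d ℕ.* c ℕ.* b ≡ a ℕ.* (b ℕ.* c ℕ.* d)
      cancel = ℕSolver.solve-∀

    Q-double-ratio : ∀ {z z′ w w′ r X Y} .{{_ : NonZero Y}} →
                     E z ℕ.* E w ≡ E z′ ℕ.* E w′ ℕ.* r ℕ.* X → F z ℕ.* F w ≡ F z′ ℕ.* F w′ ℕ.* r ℕ.* Y →
                     Qratio e f z z′ * Qratio e f w w′ ≡ + X / Y
    Q-double-ratio {z} {z′} {w} {w′} {r} {X} {Y} E-identity F-identity = begin
      Qratio e f z z′ * Qratio e f w w′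
        ≡⟨ cong₂ _*_ (Qratio-fraction z z′) (Qratio-fraction w w′) ⟩
      (+ (E z ℕ.* F z′) / (F z ℕ.* E z′)) {{FE≢0 z z′}} * (+ (E w ℕ.* F w′) / (F w ℕ.* E w′)) {{FE≢0 w w′}}
        ≡⟨ ℕ/-*-/ (E z ℕ.* F z′) (F z ℕ.* E z′) (E w ℕ.* F w′) (F w ℕ.* E w′) {{FE≢0 z z′}} {{FE≢0 w w′}} ⟩
      (+ (E z ℕ.* F z′ ℕ.* (E w ℕ.* F w′)) / (F z ℕ.* E z′ ℕ.* (F w ℕ.* E w′))) {{FEFE≢0}}
        ≡⟨ ℕ/-cross (E z ℕ.* F z′ ℕ.* (E w ℕ.* F w′)) (F z ℕ.* E z′ ℕ.* (F w ℕ.* E w′)) X Y {{FEFE≢0}}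
             (cross-multiply {E z} {E w} {E z′} {E w′} {F z} {F w} {F z′} {F w′} {r} {X} {Y} E-identity F-identity) ⟩
      + X / Y
        ∎
      where
      open ≡-Reasoning
      FEFE≢0 : NonZero (F z ℕ.* E z′ ℕ.* (F w ℕ.* E w′))
      FEFE≢0 = ℕP.m*n≢0 (F z ℕ.* E z′) (F w ℕ.* E w′) {{FE≢0 z z′}} {{FE≢0 w w′}}

module Setting (p : ℕ) .{{_ : NonZero p}} (s : ℕ) {d} (c m : Vecℕ d) where

  open import Defs using (_·_; _⊕_; _⊛_; ∣_∣ᵥ; prodFact)
  open import Data.Nat
  open import Data.Nat.Properties
  open import Data.Nat.Divisibility using (_∣_; m∣m*n)
  open import Data.Nat.DivMod using (_%_)
  open import Data.Nat.Primality using (Prime)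
  open import Data.Nat.Tactic.RingSolver using (solve-∀)
  open import Data.List using (List; []; _∷_)
  open import Relation.Nullary using (¬_)
  open import Relation.Binary.PropositionalEquality
  open ≡-Reasoning
  open Factorials
  open UnitParts p
  open DotProduct

  M : ℕ
  M = p ^ suc s

  instance
    M≢0 : NonZero M
    M≢0 = m^n≢0 p (suc s)

  open Periodicity M (m∣m*n (p ^ s))

  -- The unit part of one full period; every unit factor is a power of it modulo M.
  W : ℕ
  W = unitProd 0 M

  cp A B : Vecℕ d
  cp = c ⊛ p
  A  = c ⊕ (m ⊛ (p ^ s))
  B  = cp ⊕ (m ⊛ (p ^ suc s))

  -- The power of p contributed by the multiples of p among k·pˢ blocks of length p.
  ρ : ℕ → ℕ
  ρ k = p ^ (k * p ^ s)

  ρ-+ : ∀ a b → ρ (a + b) ≡ ρ a * ρ b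
  ρ-+ a b = trans (cong (p ^_) (*-distribʳ-+ (p ^ s) a b)) (^-distribˡ-+-* p (a * p ^ s) (b * p ^ s))

  unitFactor : Vecℕ d → ℕ
  unitFactor v = unitProd ((v · c) * p) ((v · m) * M)

  unitFactors : List (Vecℕ d) → ℕ
  unitFactors []       = 1
  unitFactors (v ∷ vs) = unitFactor v * unitFactors vs

  factorial-ratio-vec : ∀ v → (v · c) ! * (v · B) ! ≡ (v · cp) ! * (v · A) ! * ρ (v · m) * unitFactor v
  factorial-ratio-vec v = begin
    (v · c) ! * (v · B) !                                      ≡⟨ cong (λ n → (v · c) ! * n !) v·B ⟩
    (v · c) ! * ((v · c) * p + L * p) !                        ≡⟨ factorial-split (v · c) L ⟩
    ((v · c) * p) ! * (v · c + L) ! * p ^ L * unitProd ((v · c) * p) (L * p)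
      ≡⟨ cong₂ (λ x y → x ! * y ! * p ^ L * unitProd ((v · c) * p) (L * p)) (sym (·-⊛ v c p)) (sym v·A) ⟩
    (v · cp) ! * (v · A) ! * p ^ L * unitProd ((v · c) * p) (L * p)
      ≡⟨ cong (λ n → (v · cp) ! * (v · A) ! * p ^ L * unitProd ((v · c) * p) n) (L*p≡k*M (v · m)) ⟩
    (v · cp) ! * (v · A) ! * ρ (v · m) * unitFactor v          ∎
    where
    L = (v · m) * p ^ s
    L*p≡k*M : ∀ k → k * p ^ s * p ≡ k * M
    L*p≡k*M k = reassoc k p (p ^ s)
      where
      reassoc : ∀ k q r → k * r * q ≡ k * (q * r)
      reassoc = solve-∀
    v·B : v · B ≡ (v · c) * p + L * p
    v·B = trans (·-⊕ʳ v cp (m ⊛ M))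
                (cong₂ _+_ (·-⊛ v c p) (trans (·-⊛ v m M) (sym (L*p≡k*M (v · m)))))
    v·A : v · A ≡ v · c + L
    v·A = trans (·-⊕ʳ v c (m ⊛ (p ^ s))) (cong (v · c +_) (·-⊛ v m (p ^ s)))

  factorial-ratio : ∀ es → prodFact es c * prodFact es B ≡
                           prodFact es cp * prodFact es A * ρ (∣ es ∣ᵥ · m) * unitFactors es
  factorial-ratio []       = cong (λ k → 1 * 1 * ρ k * 1) (sym (0·x≡0 m))
  factorial-ratio (v ∷ vs) = begin
    (v · c) ! * prodFact vs c * ((v · B) ! * prodFact vs B)
      ≡⟨ interchange ((v · c) !) (prodFact vs c) ((v · B) !) (prodFact vs B) ⟩
    (v · c) ! * (v · B) ! * (prodFact vs c * prodFact vs B)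
      ≡⟨ cong₂ _*_ (factorial-ratio-vec v) (factorial-ratio vs) ⟩
    (v · cp) ! * (v · A) ! * ρ (v · m) * unitFactor v * (prodFact vs cp * prodFact vs A * ρ (∣ vs ∣ᵥ · m) * unitFactors vs)
      ≡⟨ collect ((v · cp) !) ((v · A) !) (ρ (v · m)) (unitFactor v)
                 (prodFact vs cp) (prodFact vs A) (ρ (∣ vs ∣ᵥ · m)) (unitFactors vs) ⟩
    (v · cp) ! * prodFact vs cp * ((v · A) ! * prodFact vs A) * (ρ (v · m) * ρ (∣ vs ∣ᵥ · m)) * unitFactors (v ∷ vs)
      ≡⟨ cong (λ r → (v · cp) ! * prodFact vs cp * ((v · A) ! * prodFact vs A) * r * unitFactors (v ∷ vs)) ρ-sum ⟨
    (v · cp) ! * prodFact vs cp * ((v · A) ! * prodFact vs A) * ρ (∣ v ∷ vs ∣ᵥ · m) * unitFactors (v ∷ vs) ∎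
    where
    ρ-sum : ρ (∣ v ∷ vs ∣ᵥ · m) ≡ ρ (v · m) * ρ (∣ vs ∣ᵥ · m)
    ρ-sum = trans (cong ρ (·-⊕ˡ v ∣ vs ∣ᵥ m)) (ρ-+ (v · m) (∣ vs ∣ᵥ · m))
    interchange : ∀ a b c d → a * b * (c * d) ≡ a * c * (b * d)
    interchange = solve-∀
    collect : ∀ a b c d e f g h → a * b * c * d * (e * f * g * h) ≡ a * e * (b * f) * (c * g) * (d * h)
    collect = solve-∀

  unitFactors-mod : ∀ es → unitFactors es % M ≡ (W ^ (∣ es ∣ᵥ · m)) % M
  unitFactors-mod []       = cong (λ k → (W ^ k) % M) (sym (0·x≡0 m))
  unitFactors-mod (v ∷ vs) = begin
    (unitFactor v * unitFactors vs) % M              ≡⟨ *-cong-mod {M} (unitProd-periods ((v · c) * p) (v · m)) (unitFactors-mod vs) ⟩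
    (W ^ (v · m) * W ^ (∣ vs ∣ᵥ · m)) % M            ≡⟨ cong (_% M) (^-distribˡ-+-* W (v · m) (∣ vs ∣ᵥ · m)) ⟨
    (W ^ (v · m + ∣ vs ∣ᵥ · m)) % M                  ≡⟨ cong (λ k → (W ^ k) % M) (·-⊕ˡ v ∣ vs ∣ᵥ m) ⟨
    (W ^ (∣ v ∷ vs ∣ᵥ · m)) % M                      ∎

  unitFactors-coprime : Prime p → ∀ es → ¬ p ∣ unitFactors es
  unitFactors-coprime p-prime []       = ∤1 p-prime
  unitFactors-coprime p-prime (v ∷ vs) =
    ∤-* p-prime (unitProd-coprime p-prime ((v · c) * p) ((v · m) * M)) (unitFactors-coprime p-prime vs)

open import Defs using (∣_∣ᵥ; _·_; _⊕_; _⊛_; prodFact; Qratio; In1+p^tZp)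
open import Data.Nat as ℕ using (suc; _^_; _<_)
open import Data.Nat.Primality using (Prime; prime⇒nonZero)
open import Data.Nat.DivMod using (_%_)
open import Data.List using (List)
open import Data.Vec.Relation.Unary.All using (All)
open import Data.Integer using (+_)
open import Data.Rational using (_*_; _/_)
open import Relation.Binary.PropositionalEquality using (_≡_; cong; subst; sym; module ≡-Reasoning)
open Fractions using (congruent-units-ratio; module QuotientOfFactorials)

lemma7 : (p : ℕ) → Prime p → (d : ℕ) → (e f : List (Vecℕ d)) → ∣ e ∣ᵥ ≡ ∣ f ∣ᵥ →
    (s : ℕ) → (c : Vecℕ d) → All (λ ci → ci < p ^ s) c → (m : Vecℕ d) →
      In1+p^tZp p (suc s)
        (Qratio e f c (c ⊛ p) * Qratio e f ((c ⊛ p) ⊕ (m ⊛ (p ^ suc s))) (c ⊕ (m ⊛ (p ^ s))))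
lemma7 p p-prime d e f |e|≡|f| s c _ m =
  subst (In1+p^tZp p (suc s)) (sym double-ratio≡X/Y)
        (congruent-units-ratio p (suc s) X Y (unitFactors-coprime p-prime f) X≡Y)
  where
  instance
    p≢0 : NonZero p
    p≢0 = prime⇒nonZero p-prime
  open Setting p s c m
  open QuotientOfFactorials e f using (Q-double-ratio)
  X Y : ℕ
  X = unitFactors e
  Y = unitFactors f
  instance
    Y≢0 : NonZero Y
    Y≢0 = Factorials.∤⇒nonZero (unitFactors-coprime p-prime f)
  X≡Y : X % M ≡ Y % M
  X≡Y = begin
    X % M                      ≡⟨ unitFactors-mod e ⟩
    (W ^ (∣ e ∣ᵥ · m)) % M     ≡⟨ cong (λ v → (W ^ (v · m)) % M) |e|≡|f| ⟩
    (W ^ (∣ f ∣ᵥ · m)) % M     ≡⟨ sym (unitFactors-mod f) ⟩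
    Y % M                      ∎
    where open ≡-Reasoning
  -- the powers of p in the two factorial identities agree, again because |e| = |f|
  double-ratio≡X/Y : Qratio e f c cp * Qratio e f B A ≡ + X / Y
  double-ratio≡X/Y = Q-double-ratio (factorial-ratio e)
    (subst (λ v → prodFact f c ℕ.* prodFact f B ≡ prodFact f cp ℕ.* prodFact f A ℕ.* ρ (v · m) ℕ.* Y)
           (sym |e|≡|f|) (factorial-ratio f))
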